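{- Let $P$ be a $\Sigma$-pattern of length $r\ge2$ having exactly one gap $f$, located at its last position. Let $a,b$ be positive integers with $a\le b$ and $\gcd(b,r)=1$, let $m\ge1$ be minimal such that $b$ divides $r^m-1$, and define $$P_{a,b}=P^{(m)}(a)\,P^{(m)}(a+b)\,P^{(m)}(a+2b)\cdots P^{(m)}(a+b(r^m-1)),$$ where indices of $P^{(m)}$ are taken modulo $r^m$ with representatives $1,\dots,r^m$. Then $\mathrm{T}(P)_{a,b}=\mathrm{T}(P_{a,b})$.
   Context: $\Sigma$ is a finite cyclic group; gaps are bijections of $\Sigma$, $?$ the identity. Patterns are indexed $P(1)\dots P(|P|)$. For words $x,y$ over $\Sigma\cup\mathrm{S}_\Sigma$: $x\langle\varepsilon\rangle=x$, $(a\,x)\langle y\rangle=a\,x\langle y\rangle$, $(f\,x)\langle b\,y\rangle=f(b)\,x\langle y\rangle$, $(f\,x)\langle g\,y\rangle=(f\circ g)\,x\langle y\rangle$. For $P$ with first symbol in $\Sigma$: $T_0=?^\omega$, $T_{i+1}=P^\omega\langle T_i\rangle$, $\mathrm{T}(P)=\lim T_i$, indexed by positive integers. With $\xi(n,m)=m/\gcd(n,m)$ and $|P|_?$ the number of gaps: $P\circ Q=P$ if $|P|_?=0$, else $P\circ Q=P^{d_1}\langle Q^{d_2}\rangle$ with $d_1=\xi(|P|_?,|Q|)$, $d_2=\xi(|Q|,|P|_?)$; $P^{(0)}=?$, $P^{(n+1)}=P\circ P^{(n)}$. For $\sigma$ indexed by positive integers, $\sigma_{a,b}(n)=\sigma(a+b(n-1))$.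 -}

module Defs where

open import Data.Nat using (ℕ; zero; suc; _+_; _*_; _∸_; _^_; _≤_; _%_; _/_)
open import Data.Nat.GCD using (gcd)
open import Data.Fin using (Fin)
open import Data.List using (List; []; _∷_; _++_; map; concat; replicate; length; upTo)
open import Data.Product using (∃; _×_)
open import Function using (_∘_; id)
open import Relation.Binary.PropositionalEquality using (_≡_)

-- The alphabet Σ is the finite cyclic group ℤ/(suc k), carried by Fin (suc k).
-- A symbol is either a letter of Σ or a gap (a map Σ → Σ; patterns below
-- carry a bijectivity hypothesis on their gap).  The identity gap is `?`.
data Symbol (k : ℕ) : Set where
  letter : Fin (suc k) → Symbol k
  gap    : (Fin (suc k) → Fin (suc k)) → Symbol k

hole : ∀ {k} → Symbol k
hole = gap id

Word : ℕ → Set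
Word k = List (Symbol k)

-- Infinite words, indexed from 0 (position n here = position n+1 in the paper).
Stream : Set → Set
Stream A = ℕ → A

-- x ⟨ y ⟩ for finite words, exactly by the paper's rules
-- (ε⟨y⟩ for nonempty y does not occur in the uses below; set to ε).
fill : ∀ {k} → Word k → Word k → Word k
fill x [] = x
fill [] (_ ∷ _) = []
fill (letter a ∷ x) (c ∷ y) = letter a ∷ fill x (c ∷ y)
fill (gap f ∷ x) (letter b ∷ y) = letter (f b) ∷ fill x y
fill (gap f ∷ x) (gap g ∷ y) = gap (f ∘ g) ∷ fill x y

fillω : ∀ {k} → Stream (Symbol k) → Stream (Symbol k) → Stream (Symbol k)
fillω x y zero with x zero | y zero
... | letter a | _ = letter a
... | gap f | letter b = letter (f b)
... | gap f | gap g = gap (f ∘ g)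
fillω x y (suc n) with x zero
... | letter a = fillω (x ∘ suc) y n
... | gap f = fillω (x ∘ suc) (y ∘ suc) n

pow : ∀ {k} → Word k → ℕ → Word k
pow P d = concat (replicate d P)

-- n-th entry (0-based) of a finite word, with a junk default out of range.
nth : ∀ {k} → Word k → ℕ → Symbol k
nth [] _ = hole
nth (x ∷ xs) zero = x
nth (x ∷ xs) (suc n) = nth xs n

-- n mod d (with n mod 0 = n; only used with d ≠ 0)
modN : ℕ → ℕ → ℕ
modN n zero = n
modN n (suc d) = n % suc d

omega : ∀ {k} → Word k → Stream (Symbol k)
omega P n = nth P (modN n (length P))

isGap : ∀ {k} → Symbol k → ℕ
isGap (letter _) = 0
isGap (gap _) = 1

nGaps : ∀ {k} → Word k → ℕ
nGaps [] = 0
nGaps (x ∷ xs) = isGap x + nGaps xs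

ξ : ℕ → ℕ → ℕ
ξ n m with gcd n m
... | zero = 0
... | suc g = m / suc g

compose : ∀ {k} → Word k → Word k → Word k
compose P Q with nGaps P
... | zero = P
... | suc g = fill (pow P (ξ (suc g) (length Q))) (pow Q (ξ (length Q) (suc g)))

iter : ∀ {k} → Word k → ℕ → Word k
iter P zero = hole ∷ []
iter P (suc n) = compose P (iter P n)

Tseq : ∀ {k} → Word k → ℕ → Stream (Symbol k)
Tseq P zero = λ _ → hole
Tseq P (suc i) = fillω (omega P) (Tseq P i)

IsT : ∀ {k} → Word k → Stream (Fin (suc k)) → Set
IsT P τ = ∀ n → ∃ λ i₀ → ∀ i → i₀ ≤ i → Tseq P i n ≡ letter (τ n)

-- σ_{a,b}(n) = σ(a + b(n-1)) for 1-based n; in 0-based form: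
-- σ_{a,b}(n) = σ((a - 1) + b n).
sub : {A : Set} → Stream A → ℕ → ℕ → Stream A
sub σ a b n = σ ((a ∸ 1) + b * n)

-- P_{a,b} = P^(m)(a) P^(m)(a+b) ... P^(m)(a+b(r^m-1)), indices of P^(m)
-- taken mod r^m with representatives 1..r^m  (0-based: (a+bj-1) mod r^m).
Pab : ∀ {k} → Word k → ℕ → ℕ → ℕ → ℕ → Word k
Pab P r m a b = map (λ j → nth (iter P m) (modN ((a + b * j) ∸ 1) (r ^ m))) (upTo (r ^ m))

oneGapPattern : ∀ {k} → List (Fin (suc k)) → (Fin (suc k) → Fin (suc k)) → Word k
oneGapPattern ps f = map letter ps ++ (gap f ∷ [])

module Submission where

-- The word T(P) is characterised by a
-- self-similarity: a stream σ equals T(Q) as soon as Q has a single gap h,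
-- at a position g ≥ 1, all other positions j of Q are the letters
-- σ(j + qL) (L = |Q|), and σ(g + qL) = h(σ(q)).  This is the criterion
-- `selfSimilar⇒IsT`, proved by strong induction on positions: the i-th
-- approximation T_i is correct at n once i > n.
--
-- The proof then consists of three applications of the criterion.
--  * Define τ by τ(n) = P(n mod r)[τ(n div r)]; it is self-similar for P,
--    so τ = T(P).
--  * Composing one-gap patterns blockwise shows that P^(m) has length r^m,
--    its single gap f^m in the last position, and is self-similar for τ
--    (`iter-gap`, `iter-letter`, `τ-gapᵐ`).
--  * If b ∣ r^m − 1 = e·b and 1 ≤ a ≤ b, the pattern P_{a,b} has its only
--    gap at the 0-based position a·e, and the subsequence τ_{a,b} is
--    self-similar for it (`selfSimilar-Pab`).

open import Defs
open import Data.Nat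
open import Data.Nat.Properties
open import Data.Nat.DivMod
open import Data.Nat.Induction using (<-rec)
open import Data.Nat.GCD using (gcd; gcd-zeroˡ; gcd-zeroʳ)
open import Data.Nat.Divisibility using (_∣_; divides)
open import Data.Nat.Tactic.RingSolver using (solve-∀)
open import Data.Fin using (Fin)
open import Data.List using (List; []; _∷_; _++_; map; length; upTo; applyUpTo)
open import Data.List.Properties using (length-map; length-upTo; ++-identityʳ)
open import Data.Product using (∃; _×_; _,_)
open import Data.Empty using (⊥-elim)
open import Relation.Nullary using (yes; no)
open import Function using (_∘_; id)
open import Function.Definitions using (Bijective)
open import Relation.Binary.PropositionalEquality

modN-suc : ∀ n {M L'} → M ≡ suc L' → modN n M ≡ n % suc L'
modN-suc n refl = refl

%-digit : ∀ j q L' → j < suc L' → (j + q * suc L') % suc L' ≡ j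
%-digit j q L' j<L = trans ([m+kn]%n≡m%n j q (suc L')) (m<n⇒m%n≡m j<L)

/-digit : ∀ j q L' → j < suc L' → (j + q * suc L') / suc L' ≡ q
/-digit j q L' j<L =
  trans (+-distrib-/ j (q * L) digits<L) (cong₂ _+_ (m<n⇒m/n≡0 j<L) (m*n/n≡m q L))
  where
  L : ℕ
  L = suc L'
  digits<L : j % L + (q * L) % L < L
  digits<L = subst₂ (λ u v → u + v < L) (sym (m<n⇒m%n≡m j<L)) (sym (m*n%n≡0 q L))
               (subst (_< L) (sym (+-identityʳ j)) j<L)

suc-∸1 : ∀ n → 1 ≤ n → suc (n ∸ 1) ≡ n
suc-∸1 (suc n) _ = refl

∸1<self : ∀ n → 1 ≤ n → n ∸ 1 < n
∸1<self (suc n) _ = ≤-refl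

module _ {k : ℕ} where

  nth-mapUpTo : ∀ (h : ℕ → Symbol k) (u : ℕ → ℕ) n j → j < n → nth (map h (applyUpTo u n)) j ≡ h (u j)
  nth-mapUpTo h u (suc n) zero _ = refl
  nth-mapUpTo h u (suc n) (suc j) (s≤s j<) = nth-mapUpTo h (u ∘ suc) n j j<

  plugGap : (Fin (suc k) → Fin (suc k)) → Symbol k → Symbol k
  plugGap f (letter b) = letter (f b)
  plugGap f (gap g) = gap (f ∘ g)

  plug : Symbol k → Symbol k → Symbol k
  plug (letter a) _ = letter a
  plug (gap f) c = plugGap f c

  -- Number of gaps among the first n symbols of x: the position of y
  -- consumed by the n-th symbol of x⟨y⟩.
  gapsBefore : Stream (Symbol k) → ℕ → ℕ
  gapsBefore x zero = 0
  gapsBefore x (suc n) = isGap (x zero) + gapsBefore (x ∘ suc) n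

  fillω-at : ∀ x y n → fillω x y n ≡ plug (x n) (y (gapsBefore x n))
  fillω-at x y zero with x zero | y zero
  ... | letter a | _ = refl
  ... | gap f | letter b = refl
  ... | gap f | gap g = refl
  fillω-at x y (suc n) with x zero
  ... | letter a = fillω-at (x ∘ suc) y n
  ... | gap f = fillω-at (x ∘ suc) (y ∘ suc) n

  gapsBefore-+ : ∀ x n m → gapsBefore x (n + m) ≡ gapsBefore x n + gapsBefore (λ i → x (n + i)) m
  gapsBefore-+ x zero m = refl
  gapsBefore-+ x (suc n) m =
    trans (cong (isGap (x zero) +_) (gapsBefore-+ (x ∘ suc) n m))
          (sym (+-assoc (isGap (x zero)) _ _))

  gapsBefore-cong : ∀ x x' n → (∀ i → x i ≡ x' i) → gapsBefore x n ≡ gapsBefore x' n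
  gapsBefore-cong x x' zero _ = refl
  gapsBefore-cong x x' (suc n) x≗x' =
    cong₂ _+_ (cong isGap (x≗x' zero)) (gapsBefore-cong (x ∘ suc) (x' ∘ suc) n (x≗x' ∘ suc))

  gapsBefore-none : ∀ x n → (∀ i → i < n → isGap (x i) ≡ 0) → gapsBefore x n ≡ 0
  gapsBefore-none x zero _ = refl
  gapsBefore-none x (suc n) noGap =
    cong₂ _+_ (noGap zero z<s) (gapsBefore-none (x ∘ suc) n (λ i i<n → noGap (suc i) (s≤s i<n)))

-- The self-similarity criterion for T(Q)

record SelfSimilar {k : ℕ} (Q : Word k) (σ : Stream (Fin (suc k))) : Set where
  field
    L'        : ℕ
    gapPos    : ℕ
    gapMap    : Fin (suc k) → Fin (suc k)
    length-Q  : length Q ≡ suc L'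
    gapPos≥1  : 1 ≤ gapPos
    gapPos<L  : gapPos < suc L'
    Q-gap     : nth Q gapPos ≡ gap gapMap
    Q-letter  : ∀ j q → j < suc L' → j ≢ gapPos → nth Q j ≡ letter (σ (j + q * suc L'))
    σ-gap     : ∀ q → σ (gapPos + q * suc L') ≡ gapMap (σ q)

module SelfSimilarLimit {k : ℕ} {Q : Word k} {σ : Stream (Fin (suc k))} (S : SelfSimilar Q σ) where
  open SelfSimilar S

  L : ℕ
  L = suc L'

  x : Stream (Symbol k)
  x = omega Q

  x-block : ∀ j q → j < L → x (j + q * L) ≡ nth Q j
  x-block j q j<L = cong (nth Q) (trans (modN-suc (j + q * L) length-Q) (%-digit j q L' j<L))

  x-periodic : ∀ i → x (L + i) ≡ x i
  x-periodic i = cong (nth Q) (begin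
      modN (L + i) (length Q) ≡⟨ modN-suc (L + i) length-Q ⟩
      (L + i) % L             ≡⟨ cong (_% L) (+-comm L i) ⟩
      (i + L) % L             ≡⟨ [m+n]%n≡m%n i L ⟩
      i % L                   ≡⟨ sym (modN-suc i length-Q) ⟩
      modN i (length Q)       ∎)
    where open ≡-Reasoning

  isLetter : ∀ j → j < L → j ≢ gapPos → isGap (x j) ≡ 0
  isLetter j j<L j≢g =
    cong isGap (trans (cong x (sym (+-identityʳ j))) (trans (x-block j 0 j<L) (Q-letter j 0 j<L j≢g)))

  gapsBefore-gapPos : gapsBefore x gapPos ≡ 0
  gapsBefore-gapPos = gapsBefore-none x gapPos
    (λ i i<g → isLetter i (<-trans i<g gapPos<L) (λ i≡g → <-irrefl i≡g i<g))

  gapsBefore-period : gapsBefore x L ≡ 1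
  gapsBefore-period = begin
      gapsBefore x L                         ≡⟨ cong (gapsBefore x) L≡g+rest ⟩
      gapsBefore x (gapPos + suc rest)       ≡⟨ gapsBefore-+ x gapPos (suc rest) ⟩
      gapsBefore x gapPos + (isGap (x (gapPos + 0)) + gapsBefore (λ i → x (gapPos + suc i)) rest)
        ≡⟨ cong₂ _+_ gapsBefore-gapPos (cong₂ _+_ gapHere noGapAfter) ⟩
      1                                      ∎
    where
    open ≡-Reasoning
    rest : ℕ
    rest = L' ∸ gapPos
    L≡g+rest : L ≡ gapPos + suc rest
    L≡g+rest = trans (cong suc (sym (m+[n∸m]≡n (≤-pred gapPos<L)))) (sym (+-suc gapPos rest))
    gapHere : isGap (x (gapPos + 0)) ≡ 1
    gapHere = cong isGap (trans (x-block gapPos 0 gapPos<L) Q-gap)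
    noGapAfter : gapsBefore (λ i → x (gapPos + suc i)) rest ≡ 0
    noGapAfter = gapsBefore-none _ rest (λ i i<rest → isLetter (gapPos + suc i)
      (subst (gapPos + suc i <_) (sym L≡g+rest) (+-monoʳ-< gapPos (s≤s i<rest)))
      (λ e → <-irrefl (sym e) (subst (gapPos <_) (sym (+-suc gapPos i)) (s≤s (m≤m+n gapPos i)))))

  gapsBefore-gapOf : ∀ q → gapsBefore x (gapPos + q * L) ≡ q
  gapsBefore-gapOf zero = trans (cong (gapsBefore x) (+-identityʳ gapPos)) gapsBefore-gapPos
  gapsBefore-gapOf (suc q) = begin
      gapsBefore x (gapPos + (L + q * L))  ≡⟨ cong (gapsBefore x) (shift gapPos L (q * L)) ⟩
      gapsBefore x (L + (gapPos + q * L))  ≡⟨ gapsBefore-+ x L (gapPos + q * L) ⟩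
      gapsBefore x L + gapsBefore (λ i → x (L + i)) (gapPos + q * L)
        ≡⟨ cong₂ _+_ gapsBefore-period (gapsBefore-cong _ x (gapPos + q * L) x-periodic) ⟩
      1 + gapsBefore x (gapPos + q * L)    ≡⟨ cong suc (gapsBefore-gapOf q) ⟩
      suc q                                ∎
    where
    open ≡-Reasoning
    shift : ∀ g l t → g + (l + t) ≡ l + (g + t)
    shift = solve-∀

  Settled : ℕ → Set
  Settled n = ∀ i → n < i → Tseq Q i n ≡ letter (σ n)

  settled-block : ∀ j q → j < L → (∀ {n} → n < j + q * L → Settled n) → Settled (j + q * L)
  settled-block j q j<L IH (suc i) n<i with j ≟ gapPos
  ... | no j≢g = begin
      Tseq Q (suc i) (j + q * L)          ≡⟨ fillω-at x (Tseq Q i) (j + q * L) ⟩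
      plug (x (j + q * L)) (Tseq Q i (gapsBefore x (j + q * L)))
        ≡⟨ cong (λ s → plug s (Tseq Q i (gapsBefore x (j + q * L)))) (trans (x-block j q j<L) (Q-letter j q j<L j≢g)) ⟩
      letter (σ (j + q * L))              ∎
    where open ≡-Reasoning
  ... | yes refl = begin
      Tseq Q (suc i) (j + q * L)                            ≡⟨ fillω-at x (Tseq Q i) (j + q * L) ⟩
      plug (x (j + q * L)) (Tseq Q i (gapsBefore x (j + q * L)))
        ≡⟨ cong₂ plug (trans (x-block j q j<L) Q-gap) (cong (Tseq Q i) (gapsBefore-gapOf q)) ⟩
      plug (gap gapMap) (Tseq Q i q)                        ≡⟨ cong (plugGap gapMap) (IH q<n i (<-≤-trans q<n (≤-pred n<i))) ⟩
      letter (gapMap (σ q))                                 ≡⟨ cong letter (sym (σ-gap q)) ⟩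
      letter (σ (j + q * L))                                ∎
    where
    open ≡-Reasoning
    q<n : q < j + q * L
    q<n = +-mono-≤ gapPos≥1 (m≤m*n q L)

  -- Strong induction on n, writing n = j + qL with q < n.
  settled : ∀ n → Settled n
  settled = <-rec Settled λ n IH →
    subst Settled (sym (m≡m%n+[m/n]*n n L))
      (settled-block (n % L) (n / L) (m%n<n n L)
        (λ lt → IH (subst (_ <_) (sym (m≡m%n+[m/n]*n n L)) lt)))

  isT : IsT Q σ
  isT n = suc n , λ i n<i → settled n i n<i

selfSimilar⇒IsT : ∀ {k} {Q : Word k} {σ : Stream (Fin (suc k))} → SelfSimilar Q σ → IsT Q σ
selfSimilar⇒IsT S = SelfSimilarLimit.isT S

module _ {k : ℕ} (f : Fin (suc k) → Fin (suc k)) where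

  length-oneGap : ∀ us → length (oneGapPattern us f) ≡ suc (length us)
  length-oneGap [] = refl
  length-oneGap (u ∷ us) = cong suc (length-oneGap us)

  nGaps-oneGap : ∀ us → nGaps (oneGapPattern us f) ≡ 1
  nGaps-oneGap [] = refl
  nGaps-oneGap (u ∷ us) = nGaps-oneGap us

  oneGap-gap : ∀ us → nth (oneGapPattern us f) (length us) ≡ gap f
  oneGap-gap [] = refl
  oneGap-gap (u ∷ us) = oneGap-gap us

  oneGap-letter : ∀ us j → j < length us → ∃ λ c → nth (oneGapPattern us f) j ≡ letter c
  oneGap-letter (u ∷ us) zero _ = u , refl
  oneGap-letter (u ∷ us) (suc j) (s≤s j<) = oneGap-letter us j j<

  fill-block : ∀ us W c X → fill (oneGapPattern us f ++ W) (c ∷ X) ≡ map letter us ++ plugGap f c ∷ fill W X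
  fill-block [] W (letter b) X = refl
  fill-block [] W (gap g) X = refl
  fill-block (u ∷ us) W c X = cong (letter u ∷_) (fill-block us W c X)

  nth-block : ∀ us W c j → j < length (oneGapPattern us f) →
              nth (map letter us ++ plugGap f c ∷ W) j ≡ plug (nth (oneGapPattern us f) j) c
  nth-block [] W c zero _ = refl
  nth-block [] W c (suc j) (s≤s ())
  nth-block (u ∷ us) W c zero _ = refl
  nth-block (u ∷ us) W c (suc j) (s≤s j<) = nth-block us W c j j<

  nth-afterBlock : ∀ us s W i → nth (map letter us ++ s ∷ W) (length (oneGapPattern us f) + i) ≡ nth W i
  nth-afterBlock [] s W i = refl
  nth-afterBlock (u ∷ us) s W i = nth-afterBlock us s W i

  length-block : ∀ us s W → length (map letter us ++ s ∷ W) ≡ length (oneGapPattern us f) + length W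
  length-block [] s W = refl
  length-block (u ∷ us) s W = cong suc (length-block us s W)

-- ξ is read off from gcd; with gcd(1, n) = gcd(n, 1) = 1 this gives
-- ξ(1, n) = n and ξ(n, 1) = 1, so P ∘ X = P^{|X|}⟨X⟩ when P has one gap.
ξ-via-gcd : ∀ n m g → gcd n m ≡ suc g → ξ n m ≡ m / suc g
ξ-via-gcd n m g gcd≡ with gcd n m | gcd≡
... | .(suc g) | refl = refl

compose-oneGap : ∀ {k} (P X : Word k) → nGaps P ≡ 1 → compose P X ≡ fill (pow P (length X)) X
compose-oneGap P X oneGap with nGaps P | oneGap
... | .1 | refl = begin
    fill (pow P (ξ 1 (length X))) (pow X (ξ (length X) 1))
      ≡⟨ cong₂ (λ d₁ d₂ → fill (pow P d₁) (pow X d₂))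
               (trans (ξ-via-gcd 1 (length X) 0 (gcd-zeroˡ (length X))) (n/1≡n (length X)))
               (ξ-via-gcd (length X) 1 0 (gcd-zeroʳ (length X))) ⟩
    fill (pow P (length X)) (X ++ [])  ≡⟨ cong (fill (pow P (length X))) (++-identityʳ X) ⟩
    fill (pow P (length X)) X          ∎
  where open ≡-Reasoning

module OneGapComposition {k : ℕ} (us : List (Fin (suc k))) (f : Fin (suc k) → Fin (suc k)) where

  P : Word k
  P = oneGapPattern us f

  r : ℕ
  r = length P

  nth-fillPow : ∀ X j q → j < r → q < length X →
                nth (fill (pow P (length X)) X) (j + q * r) ≡ plug (nth P j) (nth X q)
  nth-fillPow (c ∷ X) j zero j<r _ =
    trans (cong₂ nth (fill-block f us (pow P (length X)) c X) (+-identityʳ j))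
          (nth-block f us _ c j j<r)
  nth-fillPow (c ∷ X) j (suc q) j<r (s≤s q<) =
    trans (cong₂ nth (fill-block f us (pow P (length X)) c X) (shift j r (q * r)))
          (trans (nth-afterBlock f us _ _ (j + q * r)) (nth-fillPow X j q j<r q<))
    where
    shift : ∀ j l t → j + (l + t) ≡ l + (j + t)
    shift = solve-∀

  length-fillPow : ∀ X → length (fill (pow P (length X)) X) ≡ length X * r
  length-fillPow [] = refl
  length-fillPow (c ∷ X) =
    trans (cong length (fill-block f us (pow P (length X)) c X))
          (trans (length-block f us _ _) (cong (r +_) (length-fillPow X)))

  iter-suc : ∀ m → iter P (suc m) ≡ fill (pow P (length (iter P m))) (iter P m)
  iter-suc m = compose-oneGap P (iter P m) (nGaps-oneGap f us)

  length-iter : ∀ m → length (iter P m) ≡ r ^ m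
  length-iter zero = refl
  length-iter (suc m) = begin
      length (iter P (suc m))  ≡⟨ cong length (iter-suc m) ⟩
      length (fill (pow P (length (iter P m))) (iter P m)) ≡⟨ length-fillPow (iter P m) ⟩
      length (iter P m) * r    ≡⟨ cong (_* r) (length-iter m) ⟩
      r ^ m * r                ≡⟨ *-comm (r ^ m) r ⟩
      r ^ suc m                ∎
    where open ≡-Reasoning

  nth-iter-suc : ∀ m j x → j < r → x < r ^ m →
                 nth (iter P (suc m)) (j + x * r) ≡ plug (nth P j) (nth (iter P m) x)
  nth-iter-suc m j x j<r x< =
    trans (cong (λ W → nth W (j + x * r)) (iter-suc m))
          (nth-fillPow (iter P m) j x j<r (subst (x <_) (sym (length-iter m)) x<))

-- The fixed point τ = T(P) of a one-gap pattern P = p p₂ … p_{r-1} f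

module FixedPoint {k : ℕ} (p : Fin (suc k)) (ps : List (Fin (suc k))) (f : Fin (suc k) → Fin (suc k)) where
  open OneGapComposition (p ∷ ps) f public

  -- Position of the gap; r = r' + 1 definitionally.
  r' : ℕ
  r' = length (oneGapPattern ps f)

  -- P begins with the letter p, so its gap is not in front.
  r'≥1 : 1 ≤ r'
  r'≥1 = subst (1 ≤_) (sym (length-oneGap f ps)) z<s

  P-gap : nth P r' ≡ gap f
  P-gap = subst (λ i → nth P i ≡ gap f) (sym (length-oneGap f ps)) (oneGap-gap f (p ∷ ps))

  apply : Symbol k → Fin (suc k) → Fin (suc k)
  apply (letter c) _ = c
  apply (gap h) a = h a

  -- τ(n) = P(n mod r)[τ(n div r)], computed with F unfolding steps.
  approx : ℕ → ℕ → Fin (suc k)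
  approx zero _ = p
  approx (suc F) n = apply (nth P (n % r)) (approx F (n / r))

  -- Since r ≥ 2, the recursion goes to strictly smaller positions.
  div<self : ∀ n → suc n / r < suc n
  div<self n = m/n<m (suc n) r (s≤s r'≥1)

  approx-stable : ∀ F F' n → n < F → n < F' → approx F n ≡ approx F' n
  approx-stable (suc F) (suc F') zero _ _ = refl
  approx-stable (suc F) (suc F') (suc n) (s≤s n<F) (s≤s n<F') =
    cong (apply (nth P (suc n % r)))
         (approx-stable F F' (suc n / r) (≤-<-trans (≤-pred (div<self n)) n<F)
                                         (≤-<-trans (≤-pred (div<self n)) n<F'))

  τ : ℕ → Fin (suc k)
  τ n = approx (suc n) n

  τ-unfold : ∀ n → τ n ≡ apply (nth P (n % r)) (τ (n / r))
  τ-unfold zero = refl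
  τ-unfold (suc n) = cong (apply (nth P (suc n % r)))
                          (approx-stable (suc n) (suc (suc n / r)) (suc n / r) (div<self n) ≤-refl)

  τ-block : ∀ j q → j < r → τ (j + q * r) ≡ apply (nth P j) (τ q)
  τ-block j q j<r = trans (τ-unfold (j + q * r))
    (cong₂ (λ i n → apply (nth P i) (τ n)) (%-digit j q r' j<r) (/-digit j q r' j<r))

  τ-letter : ∀ j q → j < r → j ≢ r' → nth P j ≡ letter (τ (j + q * r))
  τ-letter j q j<r j≢r'
    with oneGap-letter f (p ∷ ps) j (subst (j <_) (length-oneGap f ps) (≤∧≢⇒< (≤-pred j<r) j≢r'))
  ... | c , Pj≡c = trans Pj≡c (cong letter (sym (trans (τ-block j q j<r) (cong (λ s → apply s (τ q)) Pj≡c))))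

  τ-gap : ∀ q → τ (r' + q * r) ≡ f (τ q)
  τ-gap q = trans (τ-block r' q ≤-refl) (cong (λ s → apply s (τ q)) P-gap)

  selfSimilar-P : SelfSimilar P τ
  selfSimilar-P = record
    { L' = r' ; gapPos = r' ; gapMap = f ; length-Q = refl
    ; gapPos≥1 = r'≥1 ; gapPos<L = ≤-refl ; Q-gap = P-gap
    ; Q-letter = τ-letter ; σ-gap = τ-gap }

  fᵐ : ℕ → Fin (suc k) → Fin (suc k)
  fᵐ zero = id
  fᵐ (suc m) = f ∘ fᵐ m

  r^m≥1 : ∀ m → 1 ≤ r ^ m
  r^m≥1 m = m^n>0 r m

  r^m≥2 : ∀ m → 1 ≤ m → 2 ≤ r ^ m
  r^m≥2 m 1≤m = ≤-trans (s≤s r'≥1) (subst (_≤ r ^ m) (*-identityʳ r) (^-monoʳ-≤ r 1≤m))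

  -- The last position of P^(m+1) is the gap of the last block.
  lastIndex : ∀ R → 1 ≤ R → r * R ∸ 1 ≡ r' + (R ∸ 1) * r
  lastIndex (suc R') _ = arith R' r'
    where
    arith : ∀ R' r' → R' + r' * suc R' ≡ r' + R' * suc r'
    arith = solve-∀

  -- Position j of block x + yR of P, seen in P^(m+1) of length rR.
  regroup : ∀ j x y R → j + (x + y * R) * r ≡ (j + x * r) + y * (r * R)
  regroup j x y R = arith j x y R r
    where
    arith : ∀ j x y R r → j + (x + y * R) * r ≡ (j + x * r) + y * (r * R)
    arith = solve-∀

  iter-gap : ∀ m → nth (iter P m) (r ^ m ∸ 1) ≡ gap (fᵐ m)
  iter-gap zero = refl
  iter-gap (suc m) = begin
      nth (iter P (suc m)) (r ^ suc m ∸ 1)           ≡⟨ cong (nth (iter P (suc m))) (lastIndex (r ^ m) (r^m≥1 m)) ⟩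
      nth (iter P (suc m)) (r' + (r ^ m ∸ 1) * r)    ≡⟨ nth-iter-suc m r' (r ^ m ∸ 1) ≤-refl (∸1<self (r ^ m) (r^m≥1 m)) ⟩
      plug (nth P r') (nth (iter P m) (r ^ m ∸ 1))   ≡⟨ cong₂ plug P-gap (iter-gap m) ⟩
      gap (fᵐ (suc m))                               ∎
    where open ≡-Reasoning

  τ-gapᵐ : ∀ m y → τ (r ^ m ∸ 1 + y * r ^ m) ≡ fᵐ m (τ y)
  τ-gapᵐ zero y = cong τ (*-identityʳ y)
  τ-gapᵐ (suc m) y = begin
      τ (r ^ suc m ∸ 1 + y * r ^ suc m)     ≡⟨ cong τ position ⟩
      τ (r' + (r ^ m ∸ 1 + y * r ^ m) * r)  ≡⟨ τ-gap (r ^ m ∸ 1 + y * r ^ m) ⟩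
      f (τ (r ^ m ∸ 1 + y * r ^ m))         ≡⟨ cong f (τ-gapᵐ m y) ⟩
      fᵐ (suc m) (τ y)                      ∎
    where
    open ≡-Reasoning
    position : r * r ^ m ∸ 1 + y * (r * r ^ m) ≡ r' + (r ^ m ∸ 1 + y * r ^ m) * r
    position = trans (cong (_+ y * (r * r ^ m)) (lastIndex (r ^ m) (r^m≥1 m)))
                     (sym (regroup r' (r ^ m ∸ 1) y (r ^ m)))

  iter-letter : ∀ m x y → x < r ^ m → x ≢ r ^ m ∸ 1 → nth (iter P m) x ≡ letter (τ (x + y * r ^ m))
  iter-letter zero zero y _ x≢0 = ⊥-elim (x≢0 refl)
  iter-letter zero (suc x) y (s≤s ()) _
  iter-letter (suc m) x y x< x≢last =
    subst (λ z → nth (iter P (suc m)) z ≡ letter (τ (z + y * r ^ suc m))) (sym x≡digits)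
      (atDigits (x % r) (x / r) (m%n<n x r) (m<n*o⇒m/o<n (subst (x <_) (*-comm r (r ^ m)) x<))
                (λ e → x≢last (trans x≡digits e)))
    where
    x≡digits : x ≡ x % r + (x / r) * r
    x≡digits = m≡m%n+[m/n]*n x r
    atDigits : ∀ j x' → j < r → x' < r ^ m → j + x' * r ≢ r ^ suc m ∸ 1 →
               nth (iter P (suc m)) (j + x' * r) ≡ letter (τ ((j + x' * r) + y * r ^ suc m))
    atDigits j x' j<r x'< notLast with j ≟ r'
    ... | no j≢r' = begin
        nth (iter P (suc m)) (j + x' * r)                 ≡⟨ nth-iter-suc m j x' j<r x'< ⟩
        plug (nth P j) (nth (iter P m) x')                ≡⟨ cong (λ s → plug s _) (τ-letter j (x' + y * r ^ m) j<r j≢r') ⟩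
        letter (τ (j + (x' + y * r ^ m) * r))             ≡⟨ cong (letter ∘ τ) (regroup j x' y (r ^ m)) ⟩
        letter (τ ((j + x' * r) + y * r ^ suc m))         ∎
      where open ≡-Reasoning
    ... | yes refl = begin
        nth (iter P (suc m)) (r' + x' * r)                ≡⟨ nth-iter-suc m r' x' j<r x'< ⟩
        plug (nth P r') (nth (iter P m) x')               ≡⟨ cong₂ plug P-gap (iter-letter m x' y x'< x'≢last) ⟩
        letter (f (τ (x' + y * r ^ m)))                   ≡⟨ cong letter (sym (τ-gap (x' + y * r ^ m))) ⟩
        letter (τ (r' + (x' + y * r ^ m) * r))            ≡⟨ cong (letter ∘ τ) (regroup r' x' y (r ^ m)) ⟩
        letter (τ ((r' + x' * r) + y * r ^ suc m))        ∎
      where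
      open ≡-Reasoning
      x'≢last : x' ≢ r ^ m ∸ 1
      x'≢last e = notLast (trans (cong (λ z → r' + z * r) e) (sym (lastIndex (r ^ m) (r^m≥1 m))))

  -- The subsequence pattern P_{a,b}

  selfSimilar-Pab : ∀ m a b → 1 ≤ a → a ≤ b → 2 ≤ r ^ m → b ∣ r ^ m ∸ 1 →
                    SelfSimilar (Pab P r m a b) (sub τ a b)
  selfSimilar-Pab m (suc a') b _ _ 2≤R (divides zero L'≡0) =
    ⊥-elim (<-irrefl refl (subst (1 ≤_) L'≡0 (∸-monoˡ-≤ 1 2≤R)))
  selfSimilar-Pab m (suc a') b _ a≤b 2≤R (divides (suc e') L'≡eb) = record
    { L' = L' ; gapPos = g ; gapMap = fᵐ m ; length-Q = length-Q
    ; gapPos≥1 = s≤s z≤n ; gapPos<L = s≤s g≤L' ; Q-gap = Q-gap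
    ; Q-letter = Q-letter ; σ-gap = σ-gap }
    where
    e L' L g : ℕ
    e = suc e'
    L' = r ^ m ∸ 1
    L = suc L'
    g = suc a' * e
    Q : Word k
    Q = Pab P r m (suc a') b
    σ : ℕ → Fin (suc k)
    σ = sub τ (suc a') b

    R≡L : r ^ m ≡ L
    R≡L = sym (suc-∸1 (r ^ m) (r^m≥1 m))

    g≤L' : g ≤ L'
    g≤L' = subst (g ≤_) (trans (*-comm b e) (sym L'≡eb)) (*-monoˡ-≤ e a≤b)

    length-Q : length Q ≡ L
    length-Q = trans (length-map _ (upTo (r ^ m))) (trans (length-upTo (r ^ m)) R≡L)

    Q-at : ∀ j → j < L → nth Q j ≡ nth (iter P m) ((a' + b * j) % L)
    Q-at j j<L = trans (nth-mapUpTo _ id (r ^ m) j (subst (j <_) (sym R≡L) j<L))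
                       (cong (nth (iter P m)) (modN-suc (a' + b * j) R≡L))

    iter-letterL : ∀ x y → x < L → x ≢ L' → nth (iter P m) x ≡ letter (τ (x + y * L))
    iter-letterL x y = subst (λ R → x < R → x ≢ R ∸ 1 → nth (iter P m) x ≡ letter (τ (x + y * R)))
                             R≡L (iter-letter m x y)

    τ-gapL : ∀ y → τ (L' + y * L) ≡ fᵐ m (τ y)
    τ-gapL y = subst (λ R → τ (R ∸ 1 + y * R) ≡ fᵐ m (τ y)) R≡L (τ-gapᵐ m y)

    shiftBlocks : ∀ a' b j q L → a' + b * (j + q * L) ≡ (a' + b * j) + (b * q) * L
    shiftBlocks = solve-∀

    collect : ∀ s t u L → (s + t * L) + u * L ≡ s + (t + u) * L
    collect = solve-∀

    gapIndex : a' + b * g ≡ L' + a' * L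
    gapIndex = trans (arith a' b e) (cong (λ z → z + a' * suc z) (sym L'≡eb))
      where
      arith : ∀ a' b e → a' + b * (suc a' * e) ≡ e * b + a' * suc (e * b)
      arith = solve-∀

    Q-gap : nth Q g ≡ gap (fᵐ m)
    Q-gap = trans (Q-at g (s≤s g≤L'))
                  (trans (cong (λ i → nth (iter P m) (i % L)) gapIndex)
                         (trans (cong (nth (iter P m)) (%-digit L' a' L' ≤-refl)) (iter-gap m)))

    σ-gap : ∀ q → σ (g + q * L) ≡ fᵐ m (σ q)
    σ-gap q = trans (cong τ position) (τ-gapL (a' + b * q))
      where
      position : a' + b * (g + q * L) ≡ L' + (a' + b * q) * L
      position = trans (shiftBlocks a' b g q L)
                       (trans (cong (_+ (b * q) * L) gapIndex) (collect L' a' (b * q) L))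

    -- If a' + bj ≡ −1 (mod L) then j = a·e: multiply by e and use be = L − 1.
    gapUnique : ∀ j t → j < L → a' + b * j ≡ L' + t * L → j ≡ g
    gapUnique j t j<L c≡ = trans (sym (trans (cong (_% L) K≡j+) (%-digit j (suc t * e) L' j<L)))
                                 (trans (cong (_% L) K≡g+) (%-digit g j L' (s≤s g≤L')))
      where
      K : ℕ
      K = suc (a' + b * j) * e + j
      arithG : ∀ a' b j e → (suc a' + b * j) * e + j ≡ suc a' * e + j * suc (e * b)
      arithG = solve-∀
      arithJ : ∀ t L e j → (t * L) * e + j ≡ j + (t * e) * L
      arithJ = solve-∀
      K≡g+ : K ≡ g + j * L
      K≡g+ = trans (arithG a' b j e) (cong (λ z → g + j * suc z) (sym L'≡eb))
      K≡j+ : K ≡ j + (suc t * e) * L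
      K≡j+ = trans (cong (λ z → suc z * e + j) c≡) (arithJ (suc t) L e j)

    Q-letter : ∀ j q → j < L → j ≢ g → nth Q j ≡ letter (σ (j + q * L))
    Q-letter j q j<L j≢g = begin
        nth Q j                                 ≡⟨ Q-at j j<L ⟩
        nth (iter P m) s                        ≡⟨ iter-letterL s (t + b * q) (m%n<n c L) s≢L' ⟩
        letter (τ (s + (t + b * q) * L))        ≡⟨ cong (letter ∘ τ) (sym position) ⟩
        letter (σ (j + q * L))                  ∎
      where
      open ≡-Reasoning
      c s t : ℕ
      c = a' + b * j
      s = c % L
      t = c / L
      c≡s+tL : c ≡ s + t * L
      c≡s+tL = m≡m%n+[m/n]*n c L
      s≢L' : s ≢ L'
      s≢L' s≡L' = j≢g (gapUnique j t j<L (trans c≡s+tL (cong (_+ t * L) s≡L')))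
      position : a' + b * (j + q * L) ≡ s + (t + b * q) * L
      position = trans (shiftBlocks a' b j q L)
                       (trans (cong (_+ (b * q) * L) c≡s+tL) (collect s t (b * q) L))

mainTheorem17 : (k : ℕ) (ps : List (Fin (suc k))) (f : Fin (suc k) → Fin (suc k)) →
    Bijective _≡_ _≡_ f →
    let P = oneGapPattern ps f
        r = length P
    in 2 ≤ r →
       (a b : ℕ) → 1 ≤ a → a ≤ b → gcd b r ≡ 1 →
       (m : ℕ) → 1 ≤ m → b ∣ (r ^ m ∸ 1) →
       ((m′ : ℕ) → 1 ≤ m′ → b ∣ (r ^ m′ ∸ 1) → m ≤ m′) →
       ∃ λ τ → IsT P τ × IsT (Pab P r m a b) (sub τ a b)
mainTheorem17 k [] f _ (s≤s ()) _ _ _ _ _ _ _ _ _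
mainTheorem17 k (p ∷ ps) f _ _ a b 1≤a a≤b _ m 1≤m b∣r^m-1 _ =
  τ , selfSimilar⇒IsT selfSimilar-P
    , selfSimilar⇒IsT (selfSimilar-Pab m a b 1≤a a≤b (r^m≥2 m 1≤m) b∣r^m-1)
  where open FixedPoint p ps f
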